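{- The following hold for the canonical frame. \begin{enumerate} \item The frame is separated \item For $\vec{u}\in \prod_{j=1}^{j=n}Z_{i_j}$ and $\vec{v}\in \prod_{j=1}^{j=n}Z_{t_j}$ the sections $R\vec{u}$ and $S\vec{v}$ are closed elements of $\mathcal{G}(X)$ and $\mathcal{G}(Y)$, respectively \item For $x\in X, y\in Y$, the $n$-ary relations $xR, yS$ are decreasing in every argument place \end{enumerate}
   Context: Let $\mathcal{L}=(L,\leq,\wedge,\vee,0,1,f,h)$ be a bounded lattice with normal lattice operators $f$ of distribution type $(i_1,\ldots,i_n;1)$ and $h$ of type $(t_1,\ldots,t_n;\partial)$ (an operator of type $(i_1,\ldots,i_n;i_{n+1})$ is a map $\mathcal L^{i_1}\times\cdots\times\mathcal L^{i_n}\to\mathcal L^{i_{n+1}}$ distributing over finite joins in each argument, with $\mathcal L^1=\mathcal L$, $\mathcal L^\partial$ the order dual). The canonical frame is $(X,I,Y,R,S)$ with $X=Z_1$ the set of filters, $Y=Z_\partial$ the set of ideals of $\mathcal L$, $xIy$ iff $x\cap y\neq\emptyset$; Galois maps $U^\perp=\{y\mid \forall x\in U\,xIy\}$, ${}^\perp V=\{x\mid\forall y\in V\,xIy\}$, and $\mathcal G(X),\mathcal G(Y)$ the stable/co-stable sets. Preorders $x\preceq z$ iff $\{x\}^\perp\subseteq\{z\}^\perp$ (similarly on $Y$); the frame is separated if these are partial orders. Closed elements of $\mathcal G(X)$ (resp. $\mathcal G(Y)$) are the sets $\Gamma u=\{w\mid u\preceq w\}$ for $u\in X$ (resp. $u\in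 Y$). For $\vec u\in\prod_jZ_{i_j}$, $\widehat f(\vec u)$ is the filter generated by $\{f(\vec a)\mid a_j\in u_j\text{ for all }j\}$, and for $\vec v\in\prod_j Z_{t_j}$, $\widehat h(\vec v)$ is the ideal generated by $\{h(\vec a)\mid a_j\in v_j\}$. The canonical relations are $xR\vec u$ iff $\widehat f(\vec u)\subseteq x$ and $yS\vec v$ iff $\widehat h(\vec v)\subseteq y$; $R\vec u=\{x\mid xR\vec u\}$, $S\vec v=\{y\mid yS\vec v\}$. -}

module Defs where

open import Level using (Level; _⊔_; suc)
open import Data.Nat using (ℕ)
open import Data.Fin using (Fin)
open import Data.Product using (Σ; _×_; _,_; ∃)
open import Function using (const)
open import Function.Bundles using (_⇔_)
open import Relation.Unary using (Pred)
open import Relation.Binary.Lattice.Bundles using (BoundedLattice)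
open import Relation.Binary.Structures using (IsPartialOrder)
open import Data.Vec.Functional using (updateAt)

-- Distribution-type polarities: 'one' is L itself, 'dual' is the order dual L^∂.
data Pol : Set where
  one dual : Pol

module _ {c ℓ₁ ℓ₂} (L : BoundedLattice c ℓ₁ ℓ₂) where
  open BoundedLattice L

  joinP : Pol → Carrier → Carrier → Carrier
  joinP one  a b = a ∨ b
  joinP dual a b = a ∧ b

  botP : Pol → Carrier
  botP one  = ⊥
  botP dual = ⊤

  record IsNormalOperator {n : ℕ} (args : Fin n → Pol) (out : Pol)
                          (g : (Fin n → Carrier) → Carrier) : Set (c ⊔ ℓ₁) where
    field
      cong       : ∀ a b → (∀ j → a j ≈ b j) → g a ≈ g b
      distrib    : ∀ a k x y →
                   g (updateAt a k (const (joinP (args k) x y)))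
                     ≈ joinP out (g (updateAt a k (const x))) (g (updateAt a k (const y)))
      normal     : ∀ a k → g (updateAt a k (const (botP (args k)))) ≈ botP out

  record Filter (ℓ : Level) : Set (c ⊔ ℓ₂ ⊔ suc ℓ) where
    field
      mem  : Carrier → Set ℓ
      top  : mem ⊤
      meet : ∀ {a b} → mem a → mem b → mem (a ∧ b)
      up   : ∀ {a b} → a ≤ b → mem a → mem b

  record Ideal (ℓ : Level) : Set (c ⊔ ℓ₂ ⊔ suc ℓ) where
    field
      mem  : Carrier → Set ℓ
      bot  : mem ⊥
      join : ∀ {a b} → mem a → mem b → mem (a ∨ b)
      down : ∀ {a b} → a ≤ b → mem b → mem a

  module CanonicalFrame {n : ℕ} (i t : Fin n → Pol)
                        (f h : (Fin n → Carrier) → Carrier) (ℓ : Level) where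

    X : Set (c ⊔ ℓ₂ ⊔ suc ℓ)
    X = Filter ℓ

    Y : Set (c ⊔ ℓ₂ ⊔ suc ℓ)
    Y = Ideal ℓ

    Z : Pol → Set (c ⊔ ℓ₂ ⊔ suc ℓ)
    Z one  = X
    Z dual = Y

    memZ : (p : Pol) → Z p → Carrier → Set ℓ
    memZ one  u = Filter.mem u
    memZ dual u = Ideal.mem u

    _I_ : X → Y → Set (c ⊔ ℓ)
    x I y = ∃ λ a → Filter.mem x a × Ideal.mem y a

    _⁺ : ∀ {ℓU} → Pred X ℓU → Pred Y (c ⊔ ℓ₂ ⊔ suc ℓ ⊔ ℓU)
    (U ⁺) y = ∀ x → U x → x I y

    ⁺_ : ∀ {ℓV} → Pred Y ℓV → Pred X (c ⊔ ℓ₂ ⊔ suc ℓ ⊔ ℓV)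
    (⁺ V) x = ∀ y → V y → x I y

    StableX : ∀ {ℓU} → Pred X ℓU → Set (c ⊔ ℓ₂ ⊔ suc ℓ ⊔ ℓU)
    StableX U = ∀ x → U x ⇔ (⁺ (U ⁺)) x

    StableY : ∀ {ℓV} → Pred Y ℓV → Set (c ⊔ ℓ₂ ⊔ suc ℓ ⊔ ℓV)
    StableY V = ∀ y → V y ⇔ ((⁺ V) ⁺) y

    _⊥ˣ : X → Pred Y (c ⊔ ℓ)
    (x ⊥ˣ) y = x I y

    ⊥ʸ_ : Y → Pred X (c ⊔ ℓ)
    (⊥ʸ y) x = x I y

    _⪯X_ : X → X → Set (c ⊔ ℓ₂ ⊔ suc ℓ)
    x ⪯X z = ∀ y → (x ⊥ˣ) y → (z ⊥ˣ) y

    _⪯Y_ : Y → Y → Set (c ⊔ ℓ₂ ⊔ suc ℓ)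
    y ⪯Y w = ∀ x → (⊥ʸ y) x → (⊥ʸ w) x

    ⪯Z : (p : Pol) → Z p → Z p → Set (c ⊔ ℓ₂ ⊔ suc ℓ)
    ⪯Z one  = _⪯X_
    ⪯Z dual = _⪯Y_

    _≐X_ : X → X → Set (c ⊔ ℓ)
    x ≐X z = ∀ a → Filter.mem x a ⇔ Filter.mem z a

    _≐Y_ : Y → Y → Set (c ⊔ ℓ)
    y ≐Y w = ∀ a → Ideal.mem y a ⇔ Ideal.mem w a

    Separated : Set (c ⊔ ℓ₂ ⊔ suc ℓ)
    Separated = IsPartialOrder _≐X_ _⪯X_ × IsPartialOrder _≐Y_ _⪯Y_

    ΓX : X → Pred X (c ⊔ ℓ₂ ⊔ suc ℓ)
    ΓX u w = u ⪯X w

    ΓY : Y → Pred Y (c ⊔ ℓ₂ ⊔ suc ℓ)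
    ΓY u w = u ⪯Y w

    ClosedX : ∀ {ℓU} → Pred X ℓU → Set (c ⊔ ℓ₂ ⊔ suc ℓ ⊔ ℓU)
    ClosedX U = StableX U × Σ X (λ u → ∀ w → U w ⇔ ΓX u w)

    ClosedY : ∀ {ℓV} → Pred Y ℓV → Set (c ⊔ ℓ₂ ⊔ suc ℓ ⊔ ℓV)
    ClosedY V = StableY V × Σ Y (λ u → ∀ w → V w ⇔ ΓY u w)

    data FGen (u : (j : Fin n) → Z (i j)) : Carrier → Set (c ⊔ ℓ₁ ⊔ ℓ₂ ⊔ ℓ) where
      gen  : ∀ (a : Fin n → Carrier) → (∀ j → memZ (i j) (u j) (a j)) →
             ∀ {b} → b ≈ f a → FGen u b
      top  : FGen u ⊤
      meet : ∀ {a b} → FGen u a → FGen u b → FGen u (a ∧ b)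
      up   : ∀ {a b} → a ≤ b → FGen u a → FGen u b

    data HGen (v : (j : Fin n) → Z (t j)) : Carrier → Set (c ⊔ ℓ₁ ⊔ ℓ₂ ⊔ ℓ) where
      gen  : ∀ (a : Fin n → Carrier) → (∀ j → memZ (t j) (v j) (a j)) →
             ∀ {b} → b ≈ h a → HGen v b
      bot  : HGen v ⊥
      join : ∀ {a b} → HGen v a → HGen v b → HGen v (a ∨ b)
      down : ∀ {a b} → a ≤ b → HGen v b → HGen v a

    _R_ : X → ((j : Fin n) → Z (i j)) → Set (c ⊔ ℓ₁ ⊔ ℓ₂ ⊔ ℓ)
    x R u = ∀ b → FGen u b → Filter.mem x b

    _S_ : Y → ((j : Fin n) → Z (t j)) → Set (c ⊔ ℓ₁ ⊔ ℓ₂ ⊔ ℓ)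
    y S v = ∀ b → HGen v b → Ideal.mem y b

    Rsec : ((j : Fin n) → Z (i j)) → Pred X (c ⊔ ℓ₁ ⊔ ℓ₂ ⊔ ℓ)
    Rsec u x = x R u

    Ssec : ((j : Fin n) → Z (t j)) → Pred Y (c ⊔ ℓ₁ ⊔ ℓ₂ ⊔ ℓ)
    Ssec v y = y S v

-- In the canonical frame x ⪯ z holds exactly when the filter x is contained in z
-- (test against the principal ideal of an element of x), and dually for ideals, so
-- both preorders are inclusion and hence partial orders. The section R u is then the
-- principal up-set Γ f̂(u), and S v is Γ ĥ(v); every Γ u equals ⁺({u}⊥), so it is
-- stable. Finally ⪯ on an argument is inclusion, which makes f̂ and ĥ monotone and
-- x R, y S antitone in each argument place.
module Submission where

open import Defs
open import Level using (Level; _⊔_; Lift; lift)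
open import Data.Nat using (ℕ)
open import Data.Fin using (Fin; _≟_)
open import Data.Product using (_×_; _,_)
open import Function.Bundles using (_⇔_; mk⇔; Equivalence)
import Function.Properties.Equivalence as ⇔
open import Relation.Binary.Core using (Rel)
open import Relation.Binary.Structures using (IsPartialOrder)
open import Relation.Binary.PropositionalEquality using (_≡_; _≢_; refl; subst)
open import Relation.Binary.Lattice.Bundles using (BoundedLattice)
open import Relation.Nullary using (yes; no)
open import Relation.Unary using (Pred; _⊆′_)

open Equivalence using (to; from)

module _ {a c ℓ r} {A : Set a} {C : Set c} (mem : A → Pred C ℓ) {_⊑_ : Rel A r}
         (⊑⇔⊆′ : ∀ x z → x ⊑ z ⇔ mem x ⊆′ mem z) where

  ⊆′-induced-isPartialOrder : IsPartialOrder (λ x z → ∀ e → mem x e ⇔ mem z e) _⊑_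
  ⊆′-induced-isPartialOrder = record
    { isPreorder = record
      { isEquivalence = record
        { refl  = λ _ → ⇔.refl
        ; sym   = λ x≐z e → ⇔.sym (x≐z e)
        ; trans = λ x≐y y≐z e → ⇔.trans (x≐y e) (y≐z e)
        }
      ; reflexive = λ {x} {z} x≐z → from (⊑⇔⊆′ x z) (λ e → to (x≐z e))
      ; trans     = λ {x} {y} {z} x⊑y y⊑z →
          from (⊑⇔⊆′ x z) (λ e m → to (⊑⇔⊆′ y z) y⊑z e (to (⊑⇔⊆′ x y) x⊑y e m))
      }
    ; antisym = λ {x} {z} x⊑z z⊑x e → mk⇔ (to (⊑⇔⊆′ x z) x⊑z e) (to (⊑⇔⊆′ z x) z⊑x e)
    }

module CanonicalFrameProperties {c ℓ₁ ℓ₂} (L : BoundedLattice c ℓ₁ ℓ₂) (ℓ : Level)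
    {n : ℕ} (i t : Fin n → Pol)
    (f h : (Fin n → BoundedLattice.Carrier L) → BoundedLattice.Carrier L) where

  open BoundedLattice L renaming (refl to ≤-refl; trans to ≤-trans)
  open CanonicalFrame L i t f h (ℓ ⊔ c ⊔ ℓ₁ ⊔ ℓ₂)

  ↓ : Carrier → Y
  ↓ e = record
    { mem  = λ b → Lift (ℓ ⊔ c ⊔ ℓ₁) (b ≤ e)
    ; bot  = lift (minimum e)
    ; join = λ (lift b≤e) (lift b′≤e) → lift (∨-least b≤e b′≤e)
    ; down = λ b≤b′ (lift b′≤e) → lift (≤-trans b≤b′ b′≤e)
    }

  ↑ : Carrier → X
  ↑ e = record
    { mem  = λ b → Lift (ℓ ⊔ c ⊔ ℓ₁) (e ≤ b)
    ; top  = lift (maximum e)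
    ; meet = λ (lift e≤b) (lift e≤b′) → lift (∧-greatest e≤b e≤b′)
    ; up   = λ b≤b′ (lift e≤b) → lift (≤-trans e≤b b≤b′)
    }

  ⪯X⇔⊆′ : ∀ x z → x ⪯X z ⇔ Filter.mem x ⊆′ Filter.mem z
  ⪯X⇔⊆′ x z = mk⇔ ⪯⇒⊆′ (λ x⊆z y (e , e∈x , e∈y) → e , x⊆z e e∈x , e∈y)
    where
    ⪯⇒⊆′ : x ⪯X z → Filter.mem x ⊆′ Filter.mem z
    ⪯⇒⊆′ x⪯z e e∈x with x⪯z (↓ e) (e , e∈x , lift ≤-refl)
    ... | b , b∈z , lift b≤e = Filter.up z b≤e b∈z

  ⪯Y⇔⊆′ : ∀ y w → y ⪯Y w ⇔ Ideal.mem y ⊆′ Ideal.mem w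
  ⪯Y⇔⊆′ y w = mk⇔ ⪯⇒⊆′ (λ y⊆w x (e , e∈x , e∈y) → e , e∈x , y⊆w e e∈y)
    where
    ⪯⇒⊆′ : y ⪯Y w → Ideal.mem y ⊆′ Ideal.mem w
    ⪯⇒⊆′ y⪯w e e∈y with y⪯w (↑ e) (e , lift ≤-refl , e∈y)
    ... | b , lift e≤b , b∈w = Ideal.down w e≤b b∈w

  ⪯X-isPartialOrder : IsPartialOrder _≐X_ _⪯X_
  ⪯X-isPartialOrder = ⊆′-induced-isPartialOrder Filter.mem ⪯X⇔⊆′

  ⪯Y-isPartialOrder : IsPartialOrder _≐Y_ _⪯Y_
  ⪯Y-isPartialOrder = ⊆′-induced-isPartialOrder Ideal.mem ⪯Y⇔⊆′

  separated : Separated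
  separated = ⪯X-isPartialOrder , ⪯Y-isPartialOrder

  ΓX-closed : ∀ {ℓU} (U : Pred X ℓU) (u : X) → (∀ w → U w ⇔ ΓX u w) → ClosedX U
  ΓX-closed U u U≐Γu = (λ x → mk⇔ (λ x∈U y y∈U⁺ → y∈U⁺ x x∈U) (back x)) , u , U≐Γu
    where
    back : ∀ x → (⁺ (U ⁺)) x → U x
    back x x∈⁺U⁺ = from (U≐Γu x) λ y uIy → x∈⁺U⁺ y (λ w w∈U → to (U≐Γu w) w∈U y uIy)

  ΓY-closed : ∀ {ℓV} (V : Pred Y ℓV) (v : Y) → (∀ w → V w ⇔ ΓY v w) → ClosedY V
  ΓY-closed V v V≐Γv = (λ y → mk⇔ (λ y∈V x x∈⁺V → x∈⁺V y y∈V) (back y)) , v , V≐Γv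
    where
    back : ∀ y → ((⁺ V) ⁺) y → V y
    back y y∈⁺V⁺ = from (V≐Γv y) λ x xIv → y∈⁺V⁺ x (λ w w∈V → to (V≐Γv w) w∈V x xIv)

  f̂ : ((j : Fin n) → Z (i j)) → X
  f̂ u = record { mem = FGen u ; top = FGen.top ; meet = FGen.meet ; up = FGen.up }

  ĥ : ((j : Fin n) → Z (t j)) → Y
  ĥ v = record { mem = HGen v ; bot = HGen.bot ; join = HGen.join ; down = HGen.down }

  Rsec⇔Γf̂ : ∀ u w → Rsec u w ⇔ ΓX (f̂ u) w
  Rsec⇔Γf̂ u w = ⇔.sym (⪯X⇔⊆′ (f̂ u) w)

  Ssec⇔Γĥ : ∀ v w → Ssec v w ⇔ ΓY (ĥ v) w
  Ssec⇔Γĥ v w = ⇔.sym (⪯Y⇔⊆′ (ĥ v) w)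

  ⪯Z⇒⊆′ : ∀ p (u u′ : Z p) → ⪯Z p u u′ → memZ p u ⊆′ memZ p u′
  ⪯Z⇒⊆′ one  u u′ = to (⪯X⇔⊆′ u u′)
  ⪯Z⇒⊆′ dual u u′ = to (⪯Y⇔⊆′ u u′)

  ⪯Z-at⇒⊆′ : ∀ (p : Fin n → Pol) k (u u′ : (j : Fin n) → Z (p j)) →
             (∀ j → j ≢ k → u j ≡ u′ j) → ⪯Z (p k) (u k) (u′ k) →
             ∀ j → memZ (p j) (u j) ⊆′ memZ (p j) (u′ j)
  ⪯Z-at⇒⊆′ p k u u′ u≡u′ uₖ⪯u′ₖ j with j ≟ k
  ... | yes refl = ⪯Z⇒⊆′ (p j) (u j) (u′ j) uₖ⪯u′ₖ
  ... | no j≢k   = λ e → subst (λ z → memZ (p j) z e) (u≡u′ j j≢k)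

  FGen-mono : ∀ {u u′} → (∀ j → memZ (i j) (u j) ⊆′ memZ (i j) (u′ j)) →
              FGen u ⊆′ FGen u′
  FGen-mono u⊆u′ _ (gen a a∈u b≈fa) = gen a (λ j → u⊆u′ j (a j) (a∈u j)) b≈fa
  FGen-mono u⊆u′ _ top              = top
  FGen-mono u⊆u′ _ (meet g g′)      = meet (FGen-mono u⊆u′ _ g) (FGen-mono u⊆u′ _ g′)
  FGen-mono u⊆u′ _ (up b≤b′ g)      = up b≤b′ (FGen-mono u⊆u′ _ g)

  HGen-mono : ∀ {v v′} → (∀ j → memZ (t j) (v j) ⊆′ memZ (t j) (v′ j)) →
              HGen v ⊆′ HGen v′
  HGen-mono v⊆v′ _ (gen a a∈v b≈ha) = gen a (λ j → v⊆v′ j (a j) (a∈v j)) b≈ha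
  HGen-mono v⊆v′ _ bot              = bot
  HGen-mono v⊆v′ _ (join g g′)      = join (HGen-mono v⊆v′ _ g) (HGen-mono v⊆v′ _ g′)
  HGen-mono v⊆v′ _ (down b≤b′ g)    = down b≤b′ (HGen-mono v⊆v′ _ g)

  R-antitone : ∀ x {u u′} → (∀ j → memZ (i j) (u j) ⊆′ memZ (i j) (u′ j)) →
               x R u′ → x R u
  R-antitone x u⊆u′ xRu′ b g = xRu′ b (FGen-mono u⊆u′ b g)

  S-antitone : ∀ y {v v′} → (∀ j → memZ (t j) (v j) ⊆′ memZ (t j) (v′ j)) →
               y S v′ → y S v
  S-antitone y v⊆v′ ySv′ b g = ySv′ b (HGen-mono v⊆v′ b g)

lemma3p2 : ∀ {c ℓ₁ ℓ₂} (L : BoundedLattice c ℓ₁ ℓ₂) (ℓ : Level) (n : ℕ)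
    (i t : Fin n → Pol)
    (f h : (Fin n → BoundedLattice.Carrier L) → BoundedLattice.Carrier L) →
    IsNormalOperator L i one f →
    IsNormalOperator L t dual h →
    let open CanonicalFrame L i t f h (ℓ ⊔ c ⊔ ℓ₁ ⊔ ℓ₂) in
    Separated
    × ((∀ (u : (j : Fin n) → Z (i j)) → ClosedX (Rsec u))
       × (∀ (v : (j : Fin n) → Z (t j)) → ClosedY (Ssec v)))
    × ((∀ (x : X) (k : Fin n) (u u′ : (j : Fin n) → Z (i j)) →
          (∀ j → j ≢ k → u j ≡ u′ j) → ⪯Z (i k) (u k) (u′ k) →
          x R u′ → x R u)
       × (∀ (y : Y) (k : Fin n) (v v′ : (j : Fin n) → Z (t j)) →
          (∀ j → j ≢ k → v j ≡ v′ j) → ⪯Z (t k) (v k) (v′ k) →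
          y S v′ → y S v))
lemma3p2 L ℓ n i t f h _ _ =
    separated
  , ( (λ u → ΓX-closed _ (f̂ u) (Rsec⇔Γf̂ u))
    , (λ v → ΓY-closed _ (ĥ v) (Ssec⇔Γĥ v)) )
  , ( (λ x k u u′ u≡u′ uₖ⪯u′ₖ → R-antitone x (⪯Z-at⇒⊆′ i k u u′ u≡u′ uₖ⪯u′ₖ))
    , (λ y k v v′ v≡v′ vₖ⪯v′ₖ → S-antitone y (⪯Z-at⇒⊆′ t k v v′ v≡v′ vₖ⪯v′ₖ)) )
  where
  open CanonicalFrameProperties L ℓ i t f h
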